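{- Let $\mathbf D=\langle D,+,',1\rangle$ be a non-trivial orthogroupoid. Then $x+x=x$ for every $x\in D$, and $x\neq x'$ for every $x\in D$.
   Context: An orthogroupoid is an algebra $\mathbf D=\langle D,+,',1\rangle$ of type $(2,1,0)$, with $0:=1'$, satisfying: (a) $x''\approx x$; (b) $0+x\approx x$ and $x+1\approx 1$; (c) $x+x'\approx 1$; (d) for all $x,z$: if $x+z=z$ and $x'+z=z$ then $z=1$; (e) $(((z+y)'+(z+x))'+(z+y)')+z'\approx z'$; (f) $x+(x+y)\approx x+y$ and $y+(x+y)\approx x+y$. Non-trivial means $|D|>1$. -}

module Defs where

open import Level using (Level; suc; _⊔_)
open import Relation.Binary.PropositionalEquality using (_≡_; _≢_)
open import Data.Product using (∃₂)

record Orthogroupoid (a : Level) : Set (suc a) where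
  infixl 6 _⊕_
  infix 8 _′
  field
    D    : Set a
    _⊕_  : D → D → D
    _′   : D → D
    𝟙    : D

  𝟘 : D
  𝟘 = 𝟙 ′

  field
    invol     : ∀ x → (x ′) ′ ≡ x
    zero-left : ∀ x → 𝟘 ⊕ x ≡ x
    one-right : ∀ x → x ⊕ 𝟙 ≡ 𝟙
    compl     : ∀ x → x ⊕ x ′ ≡ 𝟙
    quasi     : ∀ x z → x ⊕ z ≡ z → x ′ ⊕ z ≡ z → z ≡ 𝟙
    axE       : ∀ x y z → ((((z ⊕ y) ′ ⊕ (z ⊕ x)) ′ ⊕ (z ⊕ y) ′) ⊕ z ′) ≡ z ′
    absL      : ∀ x y → x ⊕ (x ⊕ y) ≡ x ⊕ y
    absR      : ∀ x y → y ⊕ (x ⊕ y) ≡ x ⊕ y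

NonTrivial : ∀ {a} → Orthogroupoid a → Set a
NonTrivial O = ∃₂ λ (x y : Orthogroupoid.D O) → x ≢ y

module Submission where

open import Defs
open import Level using (Level)
open import Data.Product using (_×_; _,_)
open import Relation.Binary.PropositionalEquality
  using (_≡_; _≢_; sym; trans; cong; subst; module ≡-Reasoning)

module OrthogroupoidProperties {a : Level} (O : Orthogroupoid a) where
  open Orthogroupoid O
  open ≡-Reasoning

  -- Absorption with x = 𝟘, whose sum 𝟘 ⊕ y collapses to y.
  ⊕-idem : ∀ x → x ⊕ x ≡ x
  ⊕-idem x = subst (λ w → x ⊕ w ≡ w) (zero-left x) (absR 𝟘 x)

  self-compl⇒𝟙 : ∀ {x} → x ≡ x ′ → x ≡ 𝟙
  self-compl⇒𝟙 {x} x≡x′ = begin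
    x       ≡⟨ sym (⊕-idem x) ⟩
    x ⊕ x   ≡⟨ cong (x ⊕_) x≡x′ ⟩
    x ⊕ x ′ ≡⟨ compl x ⟩
    𝟙       ∎

  self-compl⇒𝟙≡𝟘 : ∀ {x} → x ≡ x ′ → 𝟙 ≡ 𝟘
  self-compl⇒𝟙≡𝟘 {x} x≡x′ = begin
    𝟙   ≡⟨ sym (self-compl⇒𝟙 x≡x′) ⟩
    x   ≡⟨ x≡x′ ⟩
    x ′ ≡⟨ cong _′ (self-compl⇒𝟙 x≡x′) ⟩
    𝟘   ∎

  -- Axiom (d) with x = 𝟙: both 𝟙 and 𝟙 ′ = 𝟘 act as left identities on z.
  𝟙≡𝟘⇒≡𝟙 : 𝟙 ≡ 𝟘 → ∀ z → z ≡ 𝟙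
  𝟙≡𝟘⇒≡𝟙 𝟙≡𝟘 z = quasi 𝟙 z 𝟙⊕z≡z (zero-left z)
    where
    𝟙⊕z≡z : 𝟙 ⊕ z ≡ z
    𝟙⊕z≡z = subst (λ w → w ⊕ z ≡ z) (sym 𝟙≡𝟘) (zero-left z)

  nonTrivial⇒≢′ : NonTrivial O → ∀ x → x ≢ x ′
  nonTrivial⇒≢′ (u , v , u≢v) x x≡x′ =
    u≢v (trans (collapse u) (sym (collapse v)))
    where
    collapse : ∀ z → z ≡ 𝟙
    collapse = 𝟙≡𝟘⇒≡𝟙 (self-compl⇒𝟙≡𝟘 x≡x′)

lemma2p7 : ∀ {a : Level} (O : Orthogroupoid a) → NonTrivial O →
    let open Orthogroupoid O in
    (∀ x → x ⊕ x ≡ x) × (∀ x → x ≢ x ′)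
lemma2p7 O nonTrivial = ⊕-idem , nonTrivial⇒≢′ nonTrivial
  where open OrthogroupoidProperties O
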